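{- Let $m>2$ and $n>0$ be odd integers. Then every tuple of $\mathbf{Z}_m^n$ belongs to a cycle of $T$, i.e. $\mathcal{C}_m^n=\mathbf{Z}_m^n$.
   Context: $\mathbf{Z}_m$ is the ring of integers modulo $m$; $T:\mathbf{Z}_m^n\to\mathbf{Z}_m^n$ is $T(a_0,\dots,a_{n-1})=(a_0+a_1,a_1+a_2,\dots,a_{n-2}+a_{n-1},a_{n-1}+a_0)$. $\mathcal{C}_m^n$ is the set of tuples $\mathbf{a}\in\mathbf{Z}_m^n$ belonging to a cycle, i.e. such that $T^{j}\mathbf{a}=\mathbf{a}$ for some positive integer $j$. -}

module Defs where

open import Data.Nat using (ℕ; zero; suc; NonZero; _<_)
import Data.Nat as ℕ
open import Data.Nat.DivMod using (_mod_)
open import Data.Fin using (Fin; toℕ)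
open import Data.Product using (∃; _×_)
open import Relation.Binary.PropositionalEquality using (_≡_)

_+ₘ_ : {m : ℕ} .{{_ : NonZero m}} → Fin m → Fin m → Fin m
_+ₘ_ {m} a b = (toℕ a ℕ.+ toℕ b) mod m

Tuple : (m n : ℕ) → Set
Tuple m n = Fin n → Fin m

next : {n : ℕ} .{{_ : NonZero n}} → Fin n → Fin n
next {n} i = suc (toℕ i) mod n

T : {m n : ℕ} .{{_ : NonZero m}} .{{_ : NonZero n}} → Tuple m n → Tuple m n
T a i = a i +ₘ a (next i)

iterate : {A : Set} → (A → A) → ℕ → A → A
iterate f zero x = x
iterate f (suc k) x = f (iterate f k x)

InCycle : {m n : ℕ} .{{_ : NonZero m}} .{{_ : NonZero n}} → Tuple m n → Set
InCycle a = ∃ λ j → 0 < j × (∀ i → iterate T j a i ≡ a i)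

-- T is injective when m and n are odd: if T a = T b, the differences d = a - b satisfy
-- d_i ≡ -d_{i+1} (mod m), and going once around the odd cycle gives d_i ≡ -d_i, i.e.
-- m ∣ 2 d_i, so d_i ≡ 0 as m is odd. An injective self-map of the finite set Z_m^n is a
-- permutation, so every point lies on a cycle: by pigeonhole T^i a = T^j a for some
-- i < j, and cancelling T^i gives T^(j-i) a = a.
module Submission where

open import Defs
open import Data.Nat using (ℕ; _<_; NonZero)
open import Data.Nat.Divisibility using (_∣_)
open import Relation.Nullary using (¬_)

open import Data.Fin using (Fin; toℕ; funToFin; finToFun)
open import Data.Fin.Properties using (toℕ-injective; toℕ<n; toℕ-fromℕ<; pigeonhole; finToFun-funToFin)
open import Data.Integer as ℤ using (ℤ; +_; _⊖_)
open import Data.Integer.Coprimality using (coprime-divisor)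
open import Data.Integer.Divisibility using () renaming (_∣_ to _∣ᵤ_)
open import Data.Integer.Divisibility.Signed as Signed
  using (divides; ∣⇒∣ᵤ; ∣ᵤ⇒∣; ∣m∣n⇒∣m+n; ∣m∣n⇒∣m-n)
import Data.Integer.Properties as ℤ
open import Data.Integer.Tactic.RingSolver using (solve-∀)
open import Data.Nat as ℕ using (zero; suc; _%_; _/_; _∸_; ∣_-_∣)
open import Data.Nat.Coprimality using (Coprime)
open import Data.Nat.Divisibility using (>⇒∤; m%n≡0⇒n∣m)
open import Data.Nat.DivMod using (m≡m%n+[m/n]*n; m%n<n; m<n⇒m%n≡m; %-distribˡ-+; m%n%n≡m%n; [m+n]%n≡m%n)
open import Data.Nat.Primality using (irreducible[2])
import Data.Nat.Properties as ℕ
open import Data.Product using (∃; _×_; _,_)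
open import Data.Sum using (inj₁; inj₂)
open import Function.Definitions using (Injective)
open import Level using (0ℓ)
open import Relation.Binary.Bundles using (Setoid)
open import Relation.Binary.PropositionalEquality as ≡ using (_≡_; _≗_; refl; cong; cong₂; subst; module ≡-Reasoning)
open import Relation.Nullary using (contradiction)

iterate-+ : ∀ {A : Set} (f : A → A) i j x → iterate f (i ℕ.+ j) x ≡ iterate f i (iterate f j x)
iterate-+ f zero    j x = refl
iterate-+ f (suc i) j x = cong f (iterate-+ f i j x)

module _ {ℓ} (S : Setoid 0ℓ ℓ) where
  open Setoid S

  iterate-injective : ∀ {f} → Injective _≈_ _≈_ f → ∀ k → Injective _≈_ _≈_ (iterate f k)
  iterate-injective f-inj zero    eq = eq
  iterate-injective f-inj (suc k) eq = iterate-injective f-inj k (f-inj eq)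

  injective⇒periodic : ∀ {N f} (code : Carrier → Fin N) → Injective _≈_ _≡_ code →
                       Injective _≈_ _≈_ f → ∀ x → ∃ λ j → 0 < j × iterate f j x ≈ x
  injective⇒periodic {N} {f} code code-inj f-inj x
    with i , j , i<j , same-code ← pigeonhole (ℕ.n<1+n N) (λ k → code (iterate f (toℕ k) x))
    = toℕ j ∸ toℕ i , ℕ.m<n⇒0<n∸m i<j , sym (iterate-injective f-inj (toℕ i) fⁱx≈fⁱ[fʲ⁻ⁱx])
    where
    fⁱx≈fⁱ[fʲ⁻ⁱx] : iterate f (toℕ i) x ≈ iterate f (toℕ i) (iterate f (toℕ j ∸ toℕ i) x)
    fⁱx≈fⁱ[fʲ⁻ⁱx] = trans (code-inj same-code) (reflexive (begin
      iterate f (toℕ j) x                              ≡⟨ cong (λ k → iterate f k x) (ℕ.m+[n∸m]≡n (ℕ.<⇒≤ i<j)) ⟨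
      iterate f (toℕ i ℕ.+ (toℕ j ∸ toℕ i)) x          ≡⟨ iterate-+ f (toℕ i) _ x ⟩
      iterate f (toℕ i) (iterate f (toℕ j ∸ toℕ i) x) ∎))
      where open ≡-Reasoning

funToFin-injective : ∀ {m n} → Injective _≗_ _≡_ (funToFin {m} {n})
funToFin-injective {x = a} {y = b} same i = ≡.trans (≡.sym (finToFun-funToFin a i))
  (≡.trans (cong (λ c → finToFun c i) same) (finToFun-funToFin b i))

toℕ-+ₘ : ∀ {m} .{{_ : NonZero m}} (x y : Fin m) → toℕ (x +ₘ y) ≡ (toℕ x ℕ.+ toℕ y) % m
toℕ-+ₘ x y = toℕ-fromℕ< _

toℕ-iterate-next : ∀ {n} .{{_ : NonZero n}} (i : Fin n) k → toℕ (iterate next k i) ≡ (toℕ i ℕ.+ k) % n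
toℕ-iterate-next {n} i zero = ≡.sym (≡.trans (cong (_% n) (ℕ.+-identityʳ (toℕ i))) (m<n⇒m%n≡m (toℕ<n i)))
toℕ-iterate-next {n} i (suc k) = begin
  toℕ (next (iterate next k i))          ≡⟨ toℕ-fromℕ< _ ⟩
  suc (toℕ (iterate next k i)) % n       ≡⟨ cong (λ r → suc r % n) (toℕ-iterate-next i k) ⟩
  (1 ℕ.+ (toℕ i ℕ.+ k) % n) % n          ≡⟨ %-distribˡ-+ 1 _ n ⟩
  (1 % n ℕ.+ (toℕ i ℕ.+ k) % n % n) % n ≡⟨ cong (λ r → (1 % n ℕ.+ r) % n) (m%n%n≡m%n _ n) ⟩
  (1 % n ℕ.+ (toℕ i ℕ.+ k) % n) % n     ≡⟨ %-distribˡ-+ 1 _ n ⟨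
  (1 ℕ.+ (toℕ i ℕ.+ k)) % n              ≡⟨ cong (_% n) (ℕ.+-suc (toℕ i) k) ⟨
  (toℕ i ℕ.+ suc k) % n                  ∎
  where open ≡-Reasoning

iterate-next-n : ∀ {n} .{{_ : NonZero n}} (i : Fin n) → iterate next n i ≡ i
iterate-next-n {n} i = toℕ-injective (begin
  toℕ (iterate next n i) ≡⟨ toℕ-iterate-next i n ⟩
  (toℕ i ℕ.+ n) % n      ≡⟨ [m+n]%n≡m%n (toℕ i) n ⟩
  toℕ i % n              ≡⟨ m<n⇒m%n≡m (toℕ<n i) ⟩
  toℕ i                  ∎)
  where open ≡-Reasoning

2∤⇒≡1+[n/2]*2 : ∀ {n} → ¬ 2 ∣ n → n ≡ suc (n / 2 ℕ.* 2)
2∤⇒≡1+[n/2]*2 {n} 2∤n with n % 2 in n%2 | m%n<n n 2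
... | 0 | _ = contradiction (m%n≡0⇒n∣m n 2 n%2) 2∤n
... | 1 | _ = ≡.trans (m≡m%n+[m/n]*n n 2) (cong (λ r → r ℕ.+ n / 2 ℕ.* 2) n%2)
... | suc (suc _) | ℕ.s≤s (ℕ.s≤s ())

2∤⇒coprime-2 : ∀ {m} → ¬ 2 ∣ m → Coprime m 2
2∤⇒coprime-2 2∤m (d∣m , d∣2) with irreducible[2] d∣2
... | inj₁ d≡1 = d≡1
... | inj₂ refl = contradiction d∣m 2∤m

∣<⇒≡0 : ∀ {m k} → m ∣ k → k < m → k ≡ 0
∣<⇒≡0 {k = zero}  _   _   = refl
∣<⇒≡0 {k = suc _} m∣k k<m = contradiction m∣k (>⇒∤ k<m)

∣m⊖n∣≡∣m-n∣ : ∀ m n → ℤ.∣ m ⊖ n ∣ ≡ ∣ m - n ∣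
∣m⊖n∣≡∣m-n∣ m n with ℕ.≤-total m n
... | inj₁ m≤n = ≡.trans (ℤ.∣⊖∣-≤ m≤n) (≡.sym (ℕ.m≤n⇒∣m-n∣≡n∸m m≤n))
... | inj₂ n≤m = begin
  ℤ.∣ m ⊖ n ∣ ≡⟨ ℤ.∣m⊖n∣≡∣n⊖m∣ m n ⟩
  ℤ.∣ n ⊖ m ∣ ≡⟨ ℤ.∣⊖∣-≤ n≤m ⟩
  m ∸ n       ≡⟨ ℕ.m≤n⇒∣m-n∣≡n∸m n≤m ⟨
  ∣ n - m ∣   ≡⟨ ℕ.∣-∣-comm n m ⟩
  ∣ m - n ∣   ∎
  where open ≡-Reasoning

%-≡⇒∣- : ∀ {m} .{{_ : NonZero m}} x y → x % m ≡ y % m → + m Signed.∣ + x ℤ.- + y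
%-≡⇒∣- {m} x y x%m≡y%m = divides (+ (x / m) ℤ.- + (y / m)) (begin
  + x ℤ.- + y
    ≡⟨ cong₂ ℤ._-_ (decompose x) (≡.trans (decompose y) (cong (λ r → + r ℤ.+ + (y / m) ℤ.* + m) (≡.sym x%m≡y%m))) ⟩
  (+ (x % m) ℤ.+ + (x / m) ℤ.* + m) ℤ.- (+ (x % m) ℤ.+ + (y / m) ℤ.* + m)
    ≡⟨ cancel-remainder (+ (x % m)) (+ (x / m)) (+ (y / m)) (+ m) ⟩
  (+ (x / m) ℤ.- + (y / m)) ℤ.* + m ∎)
  where
  open ≡-Reasoning
  decompose : ∀ z → + z ≡ + (z % m) ℤ.+ + (z / m) ℤ.* + m
  decompose z = ≡.trans (cong +_ (m≡m%n+[m/n]*n z m))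
    (≡.trans (ℤ.pos-+ (z % m) _) (cong (λ r → + (z % m) ℤ.+ r) (ℤ.pos-* (z / m) m)))
  cancel-remainder : ∀ r a b M → (r ℤ.+ a ℤ.* M) ℤ.- (r ℤ.+ b ℤ.* M) ≡ (a ℤ.- b) ℤ.* M
  cancel-remainder = solve-∀

∣-⇒≡ : ∀ {m x y} → x < m → y < m → + m Signed.∣ + x ℤ.- + y → x ≡ y
∣-⇒≡ {m} {x} {y} x<m y<m m∣x-y = ℕ.∣m-n∣≡0⇒m≡n (∣<⇒≡0 m∣∣x-y∣ ∣x-y∣<m)
  where
  m∣∣x-y∣ : m ∣ ∣ x - y ∣
  m∣∣x-y∣ = subst (m ∣_) (≡.trans (cong ℤ.∣_∣ (ℤ.m-n≡m⊖n x y)) (∣m⊖n∣≡∣m-n∣ x y)) (∣⇒∣ᵤ m∣x-y)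
  ∣x-y∣<m : ∣ x - y ∣ < m
  ∣x-y∣<m = ℕ.≤-<-trans (ℕ.∣m-n∣≤m⊔n x y) (ℕ.⊔-lub x<m y<m)

∣-half : ∀ {m} e → ¬ 2 ∣ m → + m Signed.∣ e ℤ.+ e → + m Signed.∣ e
∣-half {m} e 2∤m m∣2e = ∣ᵤ⇒∣ (coprime-divisor (+ m) (+ 2) e (2∤⇒coprime-2 2∤m)
  (subst (+ m ∣ᵤ_) (double e) (∣⇒∣ᵤ m∣2e)))
  where
  double : ∀ z → z ℤ.+ z ≡ + 2 ℤ.* z
  double = solve-∀

∣-alternating : ∀ {k} (e : ℕ → ℤ) → (∀ j → k Signed.∣ e j ℤ.+ e (suc j)) →
                ∀ t → k Signed.∣ e 0 ℤ.+ e (suc (t ℕ.* 2))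
∣-alternating e k∣e+e′ zero = k∣e+e′ 0
∣-alternating {k} e k∣e+e′ (suc t) = subst (k Signed.∣_) (telescope (e 0) (e j) (e (suc j)) (e (2 ℕ.+ j)))
  (∣m∣n⇒∣m+n (∣m∣n⇒∣m-n (∣-alternating e k∣e+e′ t) (k∣e+e′ j)) (k∣e+e′ (suc j)))
  where
  telescope : ∀ a b c d → (a ℤ.+ b) ℤ.- (b ℤ.+ c) ℤ.+ (c ℤ.+ d) ≡ a ℤ.+ d
  telescope = solve-∀
  j : ℕ
  j = suc (t ℕ.* 2)

T-injective : ∀ {m n} .{{_ : NonZero m}} .{{_ : NonZero n}} → ¬ 2 ∣ m → ¬ 2 ∣ n →
              Injective _≗_ _≗_ (T {m} {n})
T-injective {m} {n} 2∤m 2∤n {a} {b} Ta≗Tb i =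
  toℕ-injective (∣-⇒≡ (toℕ<n (a i)) (toℕ<n (b i)) (∣-half (d i) 2∤m m∣dᵢ+dᵢ))
  where
  d : Fin n → ℤ
  d j = + toℕ (a j) ℤ.- + toℕ (b j)

  m∣d+d∘next : ∀ j → + m Signed.∣ d j ℤ.+ d (next j)
  m∣d+d∘next j = subst (+ m Signed.∣_) regroup (%-≡⇒∣- (aⱼ ℕ.+ aⱼ′) (bⱼ ℕ.+ bⱼ′) same-residue)
    where
    aⱼ aⱼ′ bⱼ bⱼ′ : ℕ
    aⱼ = toℕ (a j); aⱼ′ = toℕ (a (next j)); bⱼ = toℕ (b j); bⱼ′ = toℕ (b (next j))
    same-residue : (aⱼ ℕ.+ aⱼ′) % m ≡ (bⱼ ℕ.+ bⱼ′) % m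
    same-residue = ≡.trans (≡.sym (toℕ-+ₘ (a j) _)) (≡.trans (cong toℕ (Ta≗Tb j)) (toℕ-+ₘ (b j) _))
    swap : ∀ p q r s → (p ℤ.+ q) ℤ.- (r ℤ.+ s) ≡ (p ℤ.- r) ℤ.+ (q ℤ.- s)
    swap = solve-∀
    regroup : + (aⱼ ℕ.+ aⱼ′) ℤ.- + (bⱼ ℕ.+ bⱼ′) ≡ d j ℤ.+ d (next j)
    regroup = ≡.trans (cong₂ ℤ._-_ (ℤ.pos-+ aⱼ aⱼ′) (ℤ.pos-+ bⱼ bⱼ′)) (swap (+ aⱼ) (+ aⱼ′) (+ bⱼ) (+ bⱼ′))

  once-around : iterate next (suc (n / 2 ℕ.* 2)) i ≡ i
  once-around = ≡.trans (cong (λ k → iterate next k i) (≡.sym (2∤⇒≡1+[n/2]*2 2∤n))) (iterate-next-n i)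

  m∣dᵢ+dᵢ : + m Signed.∣ d i ℤ.+ d i
  m∣dᵢ+dᵢ = subst (λ j → + m Signed.∣ d i ℤ.+ d j) once-around
    (∣-alternating (λ k → d (iterate next k i)) (λ k → m∣d+d∘next (iterate next k i)) (n / 2))

proposition6p1 : (m n : ℕ) → ¬ (2 ∣ m) → ¬ (2 ∣ n) → 2 < m → 0 < n →
    .{{_ : NonZero m}} → .{{_ : NonZero n}} →
    (a : Tuple m n) → InCycle a
proposition6p1 m n 2∤m 2∤n _ _ =
  injective⇒periodic (Fin n ≡.→-setoid Fin m) funToFin funToFin-injective (T-injective 2∤m 2∤n)
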